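{- Let $\mathcal M(K_{1,\aleph_0})$ be the class of all graphs containing the infinite star $K_{1,\aleph_0}$ as a minor. Then $\mathcal M(K_{1,\aleph_0})$ has neither the Erdős–Pósa property nor the $\aleph_0$-Erdős–Pósa property.
   Context: A class $\mathcal G$ of graphs has the Erdős–Pósa property if there is $f:\mathbb N\to\mathbb N$ such that for every graph $\Gamma$ (possibly infinite) and every $k\in\mathbb N$, either $\Gamma$ contains $k$ pairwise disjoint subgraphs each isomorphic to a member of $\mathcal G$, or there is $X\subseteq V(\Gamma)$ with $|X|\le f(k)$ such that $\Gamma-X$ contains no subgraph isomorphic to a member of $\mathcal G$. $\mathcal G$ has the $\aleph_0$-Erdős–Pósa property if for every graph $\Gamma$, either $\Gamma$ contains infinitely many pairwise disjoint subgraphs each isomorphic to a member of $\mathcal G$, or there is a finite $X\subseteq V(\Gamma)$ such that $\Gamma-X$ contains no subgraph isomorphic to a member of $\mathcal G$. -}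

module Defs where

open import Data.Nat using (ℕ; _≤_)
open import Data.Fin using (Fin)
open import Data.Bool using (Bool; true)
open import Data.Maybe using (Maybe; just; nothing)
open import Data.List using (List; length)
open import Data.List.Membership.Propositional using (_∈_)
open import Data.Product using (Σ; ∃; _×_; _,_)
open import Relation.Nullary using (¬_)
open import Relation.Binary.PropositionalEquality using (_≡_)
open import Function.Bundles using (_↔_; _⇔_; Inverse)

record Graph : Set₁ where
  field
    V      : Set
    E      : V → V → Set
    E-sym  : ∀ {x y} → E x y → E y x
    E-irr  : ∀ {x} → ¬ E x x
open Graph public

_≅_ : Graph → Graph → Set
G ≅ H = Σ (V G ↔ V H) λ φ →
  ∀ x y → E G x y ⇔ E H (Inverse.to φ x) (Inverse.to φ y)

record Subgraph (G : Graph) : Set where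
  field
    inV    : V G → Bool
    inE    : V G → V G → Bool
    inE-sym : ∀ x y → inE x y ≡ true → inE y x ≡ true
    inE-ok : ∀ x y → inE x y ≡ true → E G x y × inV x ≡ true × inV y ≡ true
open Subgraph public

asGraph : {G : Graph} → Subgraph G → Graph
asGraph {G} S = record
  { V = Σ (V G) (λ v → inV S v ≡ true)
  ; E = λ x y → inE S (Data.Product.proj₁ x) (Data.Product.proj₁ y) ≡ true
  ; E-sym = λ {x} {y} e → inE-sym S _ _ e
  ; E-irr = λ {x} e → E-irr G (Data.Product.proj₁ (inE-ok S _ _ e))
  }

_─_ : (G : Graph) → List (V G) → Graph
G ─ X = record
  { V = Σ (V G) (λ v → ¬ (v ∈ X))
  ; E = λ x y → E G (Data.Product.proj₁ x) (Data.Product.proj₁ y)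
  ; E-sym = E-sym G
  ; E-irr = E-irr G
  }

GraphClass : Set₁
GraphClass = Graph → Set

IsoToMember : GraphClass → Graph → Set₁
IsoToMember 𝒢 H = Σ Graph λ G' → 𝒢 G' × (H ≅ G')

ContainsMember : GraphClass → Graph → Set₁
ContainsMember 𝒢 G = Σ (Subgraph G) λ S → IsoToMember 𝒢 (asGraph S)

PairwiseDisjoint : {G : Graph} {I : Set} → (I → Subgraph G) → Set
PairwiseDisjoint {G} {I} F =
  ∀ (i j : I) → ¬ (i ≡ j) → ∀ (v : V G) → inV (F i) v ≡ true → inV (F j) v ≡ true → Data.Empty.⊥
  where import Data.Empty

DisjointMembers : GraphClass → Graph → Set → Set₁
DisjointMembers 𝒢 G I = Σ (I → Subgraph G) λ F →
  PairwiseDisjoint F × (∀ i → IsoToMember 𝒢 (asGraph (F i)))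

data ReachIn (G : Graph) (S : V G → Bool) : V G → V G → Set where
  here : ∀ {u} → ReachIn G S u u
  step : ∀ {u w v} → E G u w → S w ≡ true → ReachIn G S w v → ReachIn G S u v

record MinorModel (H G : Graph) : Set where
  field
    branch    : V H → V G → Bool
    nonempty  : ∀ h → Σ (V G) λ v → branch h v ≡ true
    connected : ∀ h u v → branch h u ≡ true → branch h v ≡ true → ReachIn G (branch h) u v
    disjoint  : ∀ h h' v → branch h v ≡ true → branch h' v ≡ true → h ≡ h'
    edges     : ∀ h h' → E H h h' →
                Σ (V G) λ u → Σ (V G) λ v → branch h u ≡ true × branch h' v ≡ true × E G u v

-- The infinite star K_{1,ℵ0}: centre nothing, leaves just n.
data StarE : Maybe ℕ → Maybe ℕ → Set where
  out : ∀ n → StarE nothing (just n)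
  inn : ∀ n → StarE (just n) nothing

K1ℵ0 : Graph
K1ℵ0 = record
  { V = Maybe ℕ
  ; E = StarE
  ; E-sym = λ { (out n) → inn n ; (inn n) → out n }
  ; E-irr = λ ()
  }

MinorClassStar : GraphClass
MinorClassStar G = MinorModel K1ℵ0 G

-- Erdős–Pósa property (the "either … or …" is read classically as ¬(¬A × ¬B)).
ErdosPosa : GraphClass → Set₁
ErdosPosa 𝒢 = Σ (ℕ → ℕ) λ f → ∀ (Γ : Graph) (k : ℕ) →
  ¬ ( ¬ DisjointMembers 𝒢 Γ (Fin k)
    × ¬ (Σ (List (V Γ)) λ X → length X ≤ f k × ¬ ContainsMember 𝒢 (Γ ─ X)) )

ErdosPosaℵ0 : GraphClass → Set₁
ErdosPosaℵ0 𝒢 = ∀ (Γ : Graph) →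
  ¬ ( ¬ DisjointMembers 𝒢 Γ ℕ
    × ¬ (Σ (List (V Γ)) λ X → ¬ ContainsMember 𝒢 (Γ ─ X)) )

-- The comb whose teeth are paths of length two witnesses both failures. In a
-- K_{1,ℵ0}-minor of the comb the leaf branch sets contain vertices arbitrarily
-- far out, the connected centre branch set reaches next to each of them, and the
-- spine vertex at level L separates levels ≤ L from levels > L; so the centre
-- contains a whole tail of the spine. Hence no two such subgraphs are disjoint,
-- while deleting finitely many vertices still leaves a tail of the comb, which
-- carries a K_{1,ℵ0}-minor.
module Submission where

open import Defs
open import Relation.Nullary using (¬_)

open import Data.Bool using (Bool; true; false; T)
import Data.Bool.Properties as Bool
open import Axiom.UniquenessOfIdentityProofs using (module Decidable⇒UIP)
open import Data.Empty using (⊥-elim)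
open import Data.Fin using (toℕ; fromℕ<) renaming (zero to fzero; suc to fsuc)
open import Data.Fin.Properties using (pigeonhole; toℕ-fromℕ<; ¬∀⟶∃¬)
open import Data.List using (List; map)
open import Data.List.Extrema.Nat using (max; xs≤max)
open import Data.List.Membership.Propositional using (_∈_)
open import Data.List.Membership.Propositional.Properties using (∈-map⁺)
import Data.List.Relation.Unary.All as All
open import Data.Maybe using (Maybe; just; nothing)
open import Data.Maybe.Properties using (just-injective)
open import Data.Nat using (ℕ; zero; suc; _+_; _∸_; _≤_; _<_; z≤n; s≤s; _≤?_; _<?_; _≟_; _≤ᵇ_; _≡ᵇ_)
open import Data.Nat.Properties
open import Data.Product using (Σ; _×_; _,_; proj₁; proj₂; map₁)
open import Data.Sum using (_⊎_; inj₁; inj₂; swap; [_,_]′)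
open import Function using (_∘_)
open import Function.Bundles using (Inverse; Injection; Equivalence; mk↔ₛ′; mk⇔)
open import Function.Properties.Inverse using (↔-sym; Inverse⇒Injection)
open import Relation.Nullary using (Dec; yes; no)
open import Relation.Nullary.Decidable using (isYes; _⊎-dec_; toWitness; fromWitness)
open import Relation.Binary.PropositionalEquality

private
  T⇒≡true : ∀ {b} → T b → b ≡ true
  T⇒≡true = Equivalence.to Bool.T-≡

  ≡true⇒T : ∀ {b} → b ≡ true → T b
  ≡true⇒T = Equivalence.from Bool.T-≡

  open Decidable⇒UIP Bool._≟_ using () renaming (≡-irrelevant to Bool-UIP)

ReachIn-snoc : ∀ {G S u v w} → ReachIn G S u v → E G v w → S w ≡ true → ReachIn G S u w
ReachIn-snoc here           e Sw = step e Sw here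
ReachIn-snoc (step e′ Sx r) e Sw = step e′ Sx (ReachIn-snoc r e Sw)

ReachIn-along : ∀ {G S} (w : ℕ → V G) → (∀ k → E G (w k) (w (suc k))) → (∀ k → S (w k) ≡ true) →
                ∀ j k → ReachIn G S (w j) (w k)
ReachIn-along w e S∋w zero    zero    = here
ReachIn-along w e S∋w zero    (suc k) = ReachIn-snoc (ReachIn-along w e S∋w zero k) (e k) (S∋w (suc k))
ReachIn-along {G} w e S∋w (suc j) k = step (E-sym G (e j)) (S∋w j) (ReachIn-along w e S∋w j k)

connected-via : ∀ {G S} (c : V G → V G) →
                (∀ {u} → S u ≡ true → E G u (c u)) → (∀ {u} → S u ≡ true → S (c u) ≡ true) →
                (∀ {u v} → S u ≡ true → S v ≡ true → ReachIn G S (c u) (c v)) →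
                ∀ u v → S u ≡ true → S v ≡ true → ReachIn G S u v
connected-via {G} c edge S∋c walk u v Su Sv =
  step (edge Su) (S∋c Su) (ReachIn-snoc (walk Su Sv) (E-sym G (edge Sv)) Sv)

ReachIn-crossing : ∀ {G S u w} (lv : V G → ℕ) {L} → ReachIn G S u w → S u ≡ true →
                   lv u ≤ L → L < lv w →
                   Σ (V G) λ x → Σ (V G) λ y → S x ≡ true × E G x y × lv x ≤ L × L < lv y
ReachIn-crossing lv here Su u≤L L<w = ⊥-elim (<⇒≱ L<w u≤L)
ReachIn-crossing {u = u} lv {L} (step {w = x} e Sx r) Su u≤L L<w with lv x ≤? L
... | yes x≤L = ReachIn-crossing lv r Sx x≤L L<w
... | no  x≰L = u , x , Su , e , u≤L , ≰⇒> x≰L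

record _↪_ (H G : Graph) : Set where
  field
    embed     : V H → V G
    injective : ∀ {x y} → embed x ≡ embed y → x ≡ y
    preserves : ∀ {x y} → E H x y → E G (embed x) (embed y)
open _↪_

↪-trans : ∀ {F G H} → F ↪ G → G ↪ H → F ↪ H
↪-trans ι κ = record
  { embed     = embed κ ∘ embed ι
  ; injective = injective ι ∘ injective κ
  ; preserves = preserves κ ∘ preserves ι
  }

≅-sym : ∀ {G H} → G ≅ H → H ≅ G
≅-sym {H = H} (φ , pres) = ↔-sym φ , λ x y → mk⇔
  (λ e → Equivalence.from (pres (from x) (from y))
           (subst₂ (E H) (sym (strictlyInverseˡ x)) (sym (strictlyInverseˡ y)) e))
  (λ e → subst₂ (E H) (strictlyInverseˡ x) (strictlyInverseˡ y) (Equivalence.to (pres (from x) (from y)) e))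
  where open Inverse φ

≅⇒↪ : ∀ {G H} → G ≅ H → G ↪ H
≅⇒↪ (φ , pres) = record
  { embed     = Inverse.to φ
  ; injective = Injection.injective (Inverse⇒Injection φ)
  ; preserves = λ {x} {y} → Equivalence.to (pres x y)
  }

asGraph-↪ : ∀ {G} (S : Subgraph G) → asGraph S ↪ G
asGraph-↪ S = record
  { embed     = proj₁
  ; injective = λ { {x , p} {.x , q} refl → cong (x ,_) (Bool-UIP p q) }
  ; preserves = proj₁ ∘ inE-ok S _ _
  }

member⇒ContainsMember : ∀ {𝒢 G} → (∀ x y → Dec (E G x y)) → 𝒢 G → ContainsMember 𝒢 G
member⇒ContainsMember {G = G} E? G∈𝒢 = whole , G , G∈𝒢 , iso
  where
  whole : Subgraph G
  whole = record
    { inV     = λ _ → true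
    ; inE     = λ x y → isYes (E? x y)
    ; inE-sym = λ x y e → T⇒≡true (fromWitness (E-sym G (toWitness (≡true⇒T e))))
    ; inE-ok  = λ x y e → toWitness (≡true⇒T e) , refl , refl
    }
  iso : asGraph whole ≅ G
  iso = mk↔ₛ′ proj₁ (_, refl) (λ _ → refl) (λ (v , p) → cong (v ,_) (Bool-UIP refl p))
      , λ x y → mk⇔ (toWitness ∘ ≡true⇒T) (T⇒≡true ∘ fromWitness)

injective⇒unbounded : (f : ℕ → ℕ) → (∀ {m n} → f m ≡ f n → m ≡ n) → ∀ K → Σ ℕ λ n → K ≤ f n
injective⇒unbounded f f-inj K with ¬∀⟶∃¬ (suc K) (λ i → f (toℕ i) < K) (λ i → f (toℕ i) <? K) all-small
  where
  all-small : ¬ (∀ i → f (toℕ i) < K)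
  all-small small with pigeonhole (n<1+n K) (λ i → fromℕ< (small i))
  ... | i , j , i<j , eq = <-irrefl (f-inj (begin
    f (toℕ i)                ≡⟨ toℕ-fromℕ< (small i) ⟨
    toℕ (fromℕ< (small i))   ≡⟨ cong toℕ eq ⟩
    toℕ (fromℕ< (small j))   ≡⟨ toℕ-fromℕ< (small j) ⟩
    f (toℕ j)                ∎)) i<j
    where open ≡-Reasoning
... | i , fi≮K = toℕ i , ≮⇒≥ fi≮K

-- The comb with teeth of length two

data Tier : Set where
  spine tooth tip : Tier

CombVertex : Set
CombVertex = ℕ × Tier

level : CombVertex → ℕ
level = proj₁

data Link : CombVertex → CombVertex → Set where
  spine-spine : ∀ i → Link (i , spine) (suc i , spine)
  spine-tooth : ∀ i → Link (i , spine) (i , tooth)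
  tooth-tip   : ∀ i → Link (i , tooth) (i , tip)

CombEdge : CombVertex → CombVertex → Set
CombEdge x y = Link x y ⊎ Link y x

Comb : Graph
Comb = record
  { V     = CombVertex
  ; E     = CombEdge
  ; E-sym = swap
  ; E-irr = [ (λ ()) , (λ ()) ]′
  }

link? : ∀ x y → Dec (Link x y)
link? (i , spine) (j , spine) with suc i ≟ j
... | yes refl = yes (spine-spine i)
... | no  i+1≢j = no λ { (spine-spine _) → i+1≢j refl }
link? (i , spine) (j , tooth) with i ≟ j
... | yes refl = yes (spine-tooth i)
... | no  i≢j  = no λ { (spine-tooth _) → i≢j refl }
link? (i , tooth) (j , tip) with i ≟ j
... | yes refl = yes (tooth-tip i)
... | no  i≢j  = no λ { (tooth-tip _) → i≢j refl }
link? (i , spine) (j , tip)   = no λ ()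
link? (i , tooth) (j , spine) = no λ ()
link? (i , tooth) (j , tooth) = no λ ()
link? (i , tip)   y           = no λ ()

comb-edge? : ∀ x y → Dec (CombEdge x y)
comb-edge? x y = link? x y ⊎-dec link? y x

level-edge≤ : ∀ {x y} → CombEdge x y → level y ≤ suc (level x)
level-edge≤ (inj₁ (spine-spine i)) = ≤-refl
level-edge≤ (inj₁ (spine-tooth i)) = n≤1+n i
level-edge≤ (inj₁ (tooth-tip i))   = n≤1+n i
level-edge≤ (inj₂ (spine-spine i)) = m≤n+m i 2
level-edge≤ (inj₂ (spine-tooth i)) = n≤1+n i
level-edge≤ (inj₂ (tooth-tip i))   = n≤1+n i

spine-separates : ∀ {x y L} → CombEdge x y → level x ≤ L → L < level y → x ≡ (L , spine)
spine-separates (inj₁ (spine-spine i)) i≤L L<i+1 = cong (_, spine) (≤-antisym i≤L (≤-pred L<i+1))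
spine-separates (inj₁ (spine-tooth i)) i≤L L<i   = ⊥-elim (<⇒≱ L<i i≤L)
spine-separates (inj₁ (tooth-tip i))   i≤L L<i   = ⊥-elim (<⇒≱ L<i i≤L)
spine-separates (inj₂ (spine-spine i)) i+1≤L L<i = ⊥-elim (<⇒≱ L<i (≤-trans (n≤1+n i) i+1≤L))
spine-separates (inj₂ (spine-tooth i)) i≤L L<i   = ⊥-elim (<⇒≱ L<i i≤L)
spine-separates (inj₂ (tooth-tip i))   i≤L L<i   = ⊥-elim (<⇒≱ L<i i≤L)

code : CombVertex → ℕ
code (zero  , spine) = 0
code (zero  , tooth) = 1
code (zero  , tip)   = 2
code (suc i , t)     = 3 + code (i , t)

decode : ℕ → CombVertex
decode 0 = zero , spine
decode 1 = zero , tooth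
decode 2 = zero , tip
decode (suc (suc (suc n))) = map₁ suc (decode n)

decode-code : ∀ x → decode (code x) ≡ x
decode-code (zero  , spine) = refl
decode-code (zero  , tooth) = refl
decode-code (zero  , tip)   = refl
decode-code (suc i , t)     = cong (map₁ suc) (decode-code (i , t))

code-injective : ∀ {x y} → code x ≡ code y → x ≡ y
code-injective {x} {y} eq = trans (sym (decode-code x)) (trans (cong decode eq) (decode-code y))

code-spine≤⇒≤level : ∀ m x → code (m , spine) ≤ code x → m ≤ level x
code-spine≤⇒≤level zero    x               _ = z≤n
code-spine≤⇒≤level (suc m) (zero , spine)  ()
code-spine≤⇒≤level (suc m) (zero , tooth)  (s≤s ())
code-spine≤⇒≤level (suc m) (zero , tip)    (s≤s (s≤s ()))
code-spine≤⇒≤level (suc m) (suc i , t) (s≤s (s≤s (s≤s le))) = s≤s (code-spine≤⇒≤level m (i , t) le)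

injective⇒level-unbounded : (f : ℕ → CombVertex) → (∀ {m n} → f m ≡ f n → m ≡ n) →
                            ∀ L → Σ ℕ λ n → L ≤ level (f n)
injective⇒level-unbounded f f-inj L
  with injective⇒unbounded (code ∘ f) (f-inj ∘ code-injective) (code (L , spine))
... | n , le = n , code-spine≤⇒≤level L (f n) le

-- Star minors of the comb

star-centre-meets-spine : ∀ {G} (ι : G ↪ Comb) (M : MinorModel K1ℵ0 G) →
  Σ ℕ λ L₀ → ∀ L → L₀ ≤ L → Σ (V G) λ g → MinorModel.branch M nothing g ≡ true × embed ι g ≡ (L , spine)
star-centre-meets-spine {G} ι M = level (ι′ c₀) , meets
  where
  open MinorModel M
  ι′ : V G → CombVertex
  ι′ = embed ι
  c₀ : V G
  c₀ = proj₁ (nonempty nothing)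
  c₀∈ : branch nothing c₀ ≡ true
  c₀∈ = proj₂ (nonempty nothing)

  a b : ℕ → V G
  a n = proj₁ (edges nothing (just n) (out n))
  b n = proj₁ (proj₂ (edges nothing (just n) (out n)))
  a∈ : ∀ n → branch nothing (a n) ≡ true
  a∈ n = proj₁ (proj₂ (proj₂ (edges nothing (just n) (out n))))
  b∈ : ∀ n → branch (just n) (b n) ≡ true
  b∈ n = proj₁ (proj₂ (proj₂ (proj₂ (edges nothing (just n) (out n)))))
  ab : ∀ n → E G (a n) (b n)
  ab n = proj₂ (proj₂ (proj₂ (proj₂ (edges nothing (just n) (out n)))))

  b-injective : ∀ {m n} → b m ≡ b n → m ≡ n
  b-injective {m} {n} eq =
    just-injective (disjoint (just m) (just n) (b n) (subst (λ v → branch (just m) v ≡ true) eq (b∈ m)) (b∈ n))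

  far-centre-vertex : ∀ L → Σ ℕ λ n → L < level (ι′ (a n))
  far-centre-vertex L =
    let n , L+2≤b = injective⇒level-unbounded (ι′ ∘ b) (b-injective ∘ injective ι) (2 + L)
    in n , ≤-pred (≤-trans L+2≤b (level-edge≤ (preserves ι (ab n))))

  crossing⇒meets : ∀ {L} →
    (Σ (V G) λ x → Σ (V G) λ y → branch nothing x ≡ true × E G x y × level (ι′ x) ≤ L × L < level (ι′ y)) →
    Σ (V G) λ g → branch nothing g ≡ true × ι′ g ≡ (L , spine)
  crossing⇒meets (x , y , x∈ , xy , x≤L , L<y) = x , x∈ , spine-separates (preserves ι xy) x≤L L<y

  meets : ∀ L → level (ι′ c₀) ≤ L → Σ (V G) λ g → branch nothing g ≡ true × ι′ g ≡ (L , spine)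
  meets L c₀≤L =
    let n , L<a = far-centre-vertex L
    in crossing⇒meets (ReachIn-crossing (level ∘ ι′) (connected nothing c₀ (a n) c₀∈ (a∈ n)) c₀∈ c₀≤L L<a)

star-member-⊇-spine-tail : (S : Subgraph Comb) → IsoToMember MinorClassStar (asGraph S) →
                           Σ ℕ λ L₀ → ∀ L → L₀ ≤ L → inV S (L , spine) ≡ true
star-member-⊇-spine-tail S (G , M , iso) =
  let L₀ , meets = star-centre-meets-spine (↪-trans ι (asGraph-↪ S)) M
  in L₀ , λ L L₀≤L → let g , _ , g↦L = meets L L₀≤L
                     in subst (λ v → inV S v ≡ true) g↦L (proj₂ (embed ι g))
  where
  ι : G ↪ asGraph S
  ι = ≅⇒↪ (≅-sym {asGraph S} {G} iso)

comb-¬DisjointMembers : ∀ {I} (i j : I) → ¬ (i ≡ j) → ¬ DisjointMembers MinorClassStar Comb I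
comb-¬DisjointMembers i j i≢j (F , disjoint , members) =
  let Lᵢ , ⊇ᵢ = star-member-⊇-spine-tail (F i) (members i)
      Lⱼ , ⊇ⱼ = star-member-⊇-spine-tail (F j) (members j)
  in disjoint i j i≢j (Lᵢ + Lⱼ , spine) (⊇ᵢ (Lᵢ + Lⱼ) (m≤m+n Lᵢ Lⱼ)) (⊇ⱼ (Lᵢ + Lⱼ) (m≤n+m Lⱼ Lᵢ))

-- Vertices of Comb ─ X carry a proof that they avoid X, and two such proofs
-- cannot be identified, which is why branch sets are connected through canonical
-- neighbours (connected-via). A leaf branch set therefore needs two vertices,
-- hence the teeth of length two.
module _ (X : List CombVertex) where

  private
    N : ℕ
    N = suc (max 0 (map level X))

    beyond-X : ∀ {v} → N ≤ level v → ¬ v ∈ X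
    beyond-X {v} N≤v v∈X = <⇒≱ N≤v (All.lookup (xs≤max 0 (map level X)) (∈-map⁺ level v∈X))

    Tail : Graph
    Tail = Comb ─ X

    at : ℕ → Tier → V Tail
    at k t = (k + N , t) , beyond-X (m≤n+m N k)

    star-branch : Maybe ℕ → V Tail → Bool
    star-branch nothing  ((i , spine) , _) = N ≤ᵇ i
    star-branch nothing  ((_ , tooth) , _) = false
    star-branch nothing  ((_ , tip)   , _) = false
    star-branch (just n) ((_ , spine) , _) = false
    star-branch (just n) ((i , tooth) , _) = i ≡ᵇ n + N
    star-branch (just n) ((i , tip)   , _) = i ≡ᵇ n + N

    Centre : V Tail → Set
    Centre v = star-branch nothing v ≡ true

    Leaf : ℕ → V Tail → Set
    Leaf n v = star-branch (just n) v ≡ true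

    centre∋at : ∀ k → Centre (at k spine)
    centre∋at k = T⇒≡true (≤⇒≤ᵇ (m≤n+m N k))

    leaf∋tooth : ∀ n → Leaf n (at n tooth)
    leaf∋tooth n = T⇒≡true (≡⇒≡ᵇ (n + N) (n + N) refl)

    leaf∋tip : ∀ n → Leaf n (at n tip)
    leaf∋tip n = T⇒≡true (≡⇒≡ᵇ (n + N) (n + N) refl)

    leaf-level : ∀ n v → Leaf n v → level (proj₁ v) ≡ n + N
    leaf-level n ((i , spine) , _) ()
    leaf-level n ((i , tooth) , _) h = ≡ᵇ⇒≡ i (n + N) (≡true⇒T h)
    leaf-level n ((i , tip)   , _) h = ≡ᵇ⇒≡ i (n + N) (≡true⇒T h)

    spine-offset : V Tail → ℕ
    spine-offset v = suc (level (proj₁ v)) ∸ N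

    spine-neighbour : V Tail → V Tail
    spine-neighbour v = at (spine-offset v) spine

    spine-neighbour-edge : ∀ {u} → Centre u → E Tail u (spine-neighbour u)
    spine-neighbour-edge {(i , spine) , _} N≤i =
      subst (λ j → CombEdge (i , spine) (j , spine)) (sym (m∸n+n≡m (m≤n⇒m≤1+n (≤ᵇ⇒≤ N i (≡true⇒T N≤i)))))
        (inj₁ (spine-spine i))

    centre-connected : ∀ u v → Centre u → Centre v → ReachIn Tail (star-branch nothing) u v
    centre-connected = connected-via spine-neighbour spine-neighbour-edge (λ {u} _ → centre∋at (spine-offset u))
      (λ {u} {v} _ _ → ReachIn-along (λ k → at k spine) (λ k → inj₁ (spine-spine (k + N))) centre∋at
                         (spine-offset u) (spine-offset v))

    leaf-neighbour : ℕ → V Tail → V Tail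
    leaf-neighbour n ((_ , tooth) , _) = at n tip
    leaf-neighbour n _                 = at n tooth

    leaf-neighbour-edge : ∀ n {u} → Leaf n u → E Tail u (leaf-neighbour n u)
    leaf-neighbour-edge n {(i , spine) , _} ()
    leaf-neighbour-edge n {u@((i , tooth) , _)} h =
      subst (λ j → CombEdge (i , tooth) (j , tip)) (leaf-level n u h) (inj₁ (tooth-tip i))
    leaf-neighbour-edge n {u@((i , tip) , _)} h =
      subst (λ j → CombEdge (i , tip) (j , tooth)) (leaf-level n u h) (inj₂ (tooth-tip i))

    leaf∋leaf-neighbour : ∀ n {u} → Leaf n u → Leaf n (leaf-neighbour n u)
    leaf∋leaf-neighbour n {(_ , spine) , _} ()
    leaf∋leaf-neighbour n {(_ , tooth) , _} _ = leaf∋tip n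
    leaf∋leaf-neighbour n {(_ , tip)   , _} _ = leaf∋tooth n

    leaf-neighbours-connected : ∀ n {u v} → Leaf n u → Leaf n v →
                                ReachIn Tail (star-branch (just n)) (leaf-neighbour n u) (leaf-neighbour n v)
    leaf-neighbours-connected n {(_ , spine) , _} () _
    leaf-neighbours-connected n {_} {(_ , spine) , _} _ ()
    leaf-neighbours-connected n {(_ , tooth) , _} {(_ , tooth) , _} _ _ = here
    leaf-neighbours-connected n {(_ , tooth) , _} {(_ , tip)   , _} _ _ =
      step (inj₂ (tooth-tip (n + N))) (leaf∋tooth n) here
    leaf-neighbours-connected n {(_ , tip)   , _} {(_ , tooth) , _} _ _ =
      step (inj₁ (tooth-tip (n + N))) (leaf∋tip n) here
    leaf-neighbours-connected n {(_ , tip)   , _} {(_ , tip)   , _} _ _ = here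

    star-connected : ∀ h u v → star-branch h u ≡ true → star-branch h v ≡ true → ReachIn Tail (star-branch h) u v
    star-connected nothing  = centre-connected
    star-connected (just n) =
      connected-via (leaf-neighbour n) (λ {u} → leaf-neighbour-edge n {u}) (λ {u} → leaf∋leaf-neighbour n {u})
        (λ {u} {v} → leaf-neighbours-connected n {u} {v})

    star-disjoint : ∀ h h′ v → star-branch h v ≡ true → star-branch h′ v ≡ true → h ≡ h′
    star-disjoint nothing  nothing  _                 _  _  = refl
    star-disjoint nothing  (just _) ((_ , spine) , _) _  ()
    star-disjoint (just _) nothing  ((_ , spine) , _) () _
    star-disjoint (just _) nothing  ((_ , tooth) , _) _  ()
    star-disjoint (just _) nothing  ((_ , tip)   , _) _  ()
    star-disjoint (just n) (just m) v h h′ =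
      cong just (+-cancelʳ-≡ N n m (trans (sym (leaf-level n v h)) (leaf-level m v h′)))

  comb-minus-finite-star-minor : MinorModel K1ℵ0 (Comb ─ X)
  comb-minus-finite-star-minor = record
    { branch    = star-branch
    ; nonempty  = λ { nothing → at 0 spine , centre∋at 0 ; (just n) → at n tooth , leaf∋tooth n }
    ; connected = star-connected
    ; disjoint  = star-disjoint
    ; edges     = λ
      { nothing (just n) (out n) → at n spine , at n tooth , centre∋at n , leaf∋tooth n , inj₁ (spine-tooth (n + N))
      ; (just n) nothing (inn n) → at n tooth , at n spine , leaf∋tooth n , centre∋at n , inj₂ (spine-tooth (n + N))
      }
    }

comb-minus-finite-contains-star-minor : (X : List CombVertex) → ContainsMember MinorClassStar (Comb ─ X)
comb-minus-finite-contains-star-minor X =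
  member⇒ContainsMember (λ x y → comb-edge? (proj₁ x) (proj₁ y)) (comb-minus-finite-star-minor X)

proposition3p7 : ¬ ErdosPosa MinorClassStar × ¬ ErdosPosaℵ0 MinorClassStar
proposition3p7 = ¬ErdosPosa , ¬ErdosPosaℵ0
  where
  ¬ErdosPosa : ¬ ErdosPosa MinorClassStar
  ¬ErdosPosa (_ , erdosPosa) = erdosPosa Comb 2
    ( comb-¬DisjointMembers fzero (fsuc fzero) (λ ())
    , λ (X , _ , ¬contains) → ¬contains (comb-minus-finite-contains-star-minor X) )

  ¬ErdosPosaℵ0 : ¬ ErdosPosaℵ0 MinorClassStar
  ¬ErdosPosaℵ0 erdosPosa = erdosPosa Comb
    ( comb-¬DisjointMembers 0 1 (λ ())
    , λ (X , ¬contains) → ¬contains (comb-minus-finite-contains-star-minor X) )
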